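{- Let $X$ be a finite set, $H$ a graph on $X$, and $\mathcal{P}^{(0)}$ any partition of $X$ (with a designated leader in each part). Let $\mathcal{P}^{(h)}$ be the partition obtained after $h$ rounds of leader compression on $\mathcal{P}^{(0)}$ with respect to $H$. Then \[\mathbb{E}\left[|\mathcal{P}^{(h)}|-|\mathcal{P}^{(0)}\oplus H|\right]\le (3/4)^h\cdot\left(|\mathcal{P}^{(0)}|-|\mathcal{P}^{(0)}\oplus H|\right),\] where $|\mathcal{P}|$ denotes the number of parts of a partition $\mathcal{P}$.
   Context: For partitions $\mathcal{P},\mathcal{Q}$ of $X$, $\mathcal{P}\oplus\mathcal{Q}$ is the finest partition that is coarser than or equal to both (every part of $\mathcal{P}$ and of $\mathcal{Q}$ is contained in a part of it); for a graph $H$, $\mathcal{P}\oplus H$ means $\mathcal{P}\oplus\mathcal{P}_H$ with $\mathcal{P}_H$ the partition into connected components of $H$. One round of leader compression on a partition $\mathcal{P}$ (each part having a leader; $\ell(x)$ is the leader of $x$'s part) with respect to $H$: each leader draws an independent uniform bit in $\{0,1\}$ and every vertex adopts the bit of its leader; every vertex $x$ with bit $1$ sends $(x,\ell(x))$ to each neighbor $y$ of $x$ in $H$; every vertex $y$ with bit $0$ that received some message selects an arbitrary one $(x,\ell(x))$ and forwards $(x,y,\ell(x))$ to its leader $\ell(y)$; every leader $z$ with bit $0$ that received some forwarded message selects an arbitrary one $(x,y,\ell(x))$, and then $z$ and all vertices whose leader is $z$ change their leader to $\ell(x)$; the partition is updated accordingly. $h$ rounds means repeating this $h$ times on the successively updated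 partitions and leaders, with fresh independent random bits each round. The expectation is over the random bits. -}

module Defs where

open import Data.Bool using (Bool; true; false; _∧_; _∨_; not; if_then_else_)
open import Data.Nat using (ℕ; zero; suc; _*_; _^_)
open import Data.Fin using (Fin; _≟_; toℕ)
open import Data.List using (List; []; _∷_; filterᵇ; allFin; lookup; length; map; concatMap; _∷ʳ_)
open import Data.Bool.ListAction using (any)
open import Data.Maybe using (Maybe; just; nothing; is-just)
open import Data.Integer using (ℤ; +_; _-_; _+_)
open import Data.Nat using (_<ᵇ_)
open import Relation.Nullary.Decidable using (⌊_⌋)
open import Relation.Binary.PropositionalEquality using (_≡_)

-- A graph on Fin n: decidable adjacency (symmetry/irreflexivity are
-- hypotheses of the theorem).
Graph : ℕ → Set
Graph n = Fin n → Fin n → Bool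

Symmetric : ∀ {n} → Graph n → Set
Symmetric {n} H = (x y : Fin n) → H x y ≡ H y x

Irreflexive : ∀ {n} → Graph n → Set
Irreflexive {n} H = (x : Fin n) → H x x ≡ false

_==_ : ∀ {n} → Fin n → Fin n → Bool
x == y = ⌊ x ≟ y ⌋

count : ∀ {n} → (Fin n → Bool) → ℕ
count {n} p = length (filterᵇ p (allFin n))

-- Partitions with leaders: a map ℓ sending each vertex to the leader of
-- its part; leaders are their own leaders. Parts = fibres of ℓ.

LeaderMap : ℕ → Set
LeaderMap n = Fin n → Fin n

IsLeaderMap : ∀ {n} → LeaderMap n → Set
IsLeaderMap {n} ℓ = (x : Fin n) → ℓ (ℓ x) ≡ ℓ x

numParts : ∀ {n} → LeaderMap n → ℕ
numParts ℓ = count (λ x → ℓ x == x)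

-- P ⊕ H : connected components of the graph whose edges are the edges
-- of H together with all pairs lying in a common part of P.
-- (Equivalently the finest partition coarser than P and P_H.)

joinAdj : ∀ {n} → LeaderMap n → Graph n → Graph n
joinAdj ℓ H x y = H x y ∨ (ℓ x == ℓ y)

reach : ∀ {n} → Graph n → ℕ → Fin n → Fin n → Bool
reach G zero    x y = x == y
reach {n} G (suc k) x y = reach G k x y ∨ any (λ z → reach G k x z ∧ G z y) (allFin n)

-- connected in G (walks of length ≤ n suffice on n vertices)
connected : ∀ {n} → Graph n → Fin n → Fin n → Bool
connected {n} G = reach G n

-- number of connected components: count vertices that are the least
-- (w.r.t. the order of Fin n) in their component
numComponents : ∀ {n} → Graph n → ℕ
numComponents {n} G =
  count (λ x → not (any (λ y → (toℕ y <ᵇ toℕ x) ∧ connected G y x) (allFin n)))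

numJoin : ∀ {n} → LeaderMap n → Graph n → ℕ
numJoin ℓ H = numComponents (joinAdj ℓ H)

-- One random bit per vertex; only the bits of leaders are used (every
-- vertex adopts the bit of its leader).
Bits : ℕ → Set
Bits n = Fin n → Bool

-- An arbitrary selection rule: given the history of random bit vectors
-- (including the current round's), the selecting vertex, and the number
-- suc k of candidates (listed in increasing order), it returns the
-- position of the selected candidate.  Since the candidate list is
-- determined by the history, this covers every (adaptive, deterministic)
-- way of making the "arbitrary" selections.
Chooser : ℕ → Set
Chooser n = List (Bits n) → Fin n → (k : ℕ) → Fin (suc k)

pick : ∀ {A : Set} → ((k : ℕ) → Fin (suc k)) → List A → Maybe A
pick c []       = nothing
pick c (a ∷ as) = just (lookup (a ∷ as) (c (length as)))

module _ {n : ℕ} (H : Graph n) where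

  -- one round; cY is used by non-leader-side receivers y, cZ by leaders z
  round : (cY cZ : Fin n → (k : ℕ) → Fin (suc k)) →
          LeaderMap n → Bits n → LeaderMap n
  round cY cZ ℓ b = λ v → newLeader (ℓ v)
    where
    bit : Fin n → Bool
    bit x = b (ℓ x)
    -- messages (x, ℓ x) received by y: from neighbours x with bit 1
    senders : Fin n → List (Fin n)
    senders y = filterᵇ (λ x → H x y ∧ bit x) (allFin n)
    -- y with bit 0 selects one message (x, ℓ x), forwarded to ℓ y
    selected : Fin n → Maybe (Fin n)
    selected y = if bit y then nothing else pick (cY y) (senders y)
    -- forwarded messages received by leader z (indexed by forwarder y)
    forwarders : Fin n → List (Fin n)
    forwarders z = filterᵇ (λ y → (ℓ y == z) ∧ is-just (selected y)) (allFin n)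
    leaderOfSel : Maybe (Fin n) → Fin n → Fin n
    leaderOfSel nothing  z = z
    leaderOfSel (just x) z = ℓ x
    newLeader : Fin n → Fin n
    newLeader z with bit z
    ... | true  = z
    ... | false with pick (cZ z) (forwarders z)
    ...   | nothing = z
    ...   | just y  = leaderOfSel (selected y) z

  runFrom : (cY cZ : Chooser n) → List (Bits n) → LeaderMap n →
            List (Bits n) → LeaderMap n
  runFrom cY cZ hist ℓ []       = ℓ
  runFrom cY cZ hist ℓ (b ∷ bs) =
    let hist' = hist ∷ʳ b in
    runFrom cY cZ hist' (round (cY hist') (cZ hist') ℓ b) bs

  compress : (cY cZ : Chooser n) → LeaderMap n → List (Bits n) → LeaderMap n
  compress cY cZ = runFrom cY cZ []

allBits : (m : ℕ) → List (Bits m)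
allBits zero    = (λ ()) ∷ []
allBits (suc m) = concatMap (λ f → (λ { Data.Fin.zero → false ; (Data.Fin.suc i) → f i })
                                 ∷ (λ { Data.Fin.zero → true ; (Data.Fin.suc i) → f i }) ∷ [])
                            (allBits m)

allSeqs : (n h : ℕ) → List (List (Bits n))
allSeqs n zero    = [] ∷ []
allSeqs n (suc h) = concatMap (λ b → map (b ∷_) (allSeqs n h)) (allBits n)

sumℤ : List ℤ → ℤ
sumℤ []       = + 0
sumℤ (z ∷ zs) = z + sumℤ zs

-- Σ over all outcomes of (|P^(h)| - |P^(0) ⊕ H|); the expectation is this
-- sum divided by 2^(n*h), the number of equally likely outcomes.
sumExcess : ∀ {n} → Graph n → (cY cZ : Chooser n) → LeaderMap n → ℕ → ℤ
sumExcess {n} H cY cZ ℓ h =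
  sumℤ (map (λ s → + numParts (compress H cY cZ ℓ s) - + numJoin ℓ H) (allSeqs n h))

-- A leader z whose part receives an H-edge from a vertex a of another part stops being a leader
-- when z draws 0 and the leader of a draws 1; for a fixed choice of a this has probability exactly
-- 1/4. The parts receiving no such edge are unions of components of P⁽⁰⁾ ⊕ H, because every round
-- only merges parts, so there are at most |P⁽⁰⁾ ⊕ H| of them. Hence one round shrinks
-- |P| − |P⁽⁰⁾ ⊕ H| by a factor 3/4 in expectation, and induction on h, conditioning on the bits of
-- the first round, gives the bound.

module Submission where

open import Data.Bool using (Bool; true; false; T; not; _∧_; if_then_else_)
open import Data.Bool.ListAction using (any)
open import Data.Bool.Properties using (T-∧; T-∨; T-≡; T-not-≡)
open import Data.Empty using (⊥; ⊥-elim)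
open import Data.Fin using (Fin; zero; suc; toℕ; fromℕ<; _≟_)
open import Data.Fin.Properties using (¬∀⟶∃¬-smallest; toℕ-injective; toℕ-inject; toℕ-fromℕ<)
open import Data.Integer using (ℤ; +_; _+_; _-_; -_; _≤_; +≤+)
open import Data.Integer using () renaming (_*_ to _*ℤ_)
import Data.Integer.Properties as ℤ
open import Data.Integer.Tactic.RingSolver using (solve-∀)
open import Data.List using (List; []; _∷_; _++_; _∷ʳ_; map; concatMap; length; filterᵇ; findᵇ; allFin)
open import Data.List.Membership.Propositional using (_∈_; lose)
open import Data.List.Membership.Propositional.Properties
  using (∈-lookup; ∈-allFin; ∈-filter⁺; ∈-filter⁻; ∈-∃++; ∈-++⁻; ∈-++⁺ˡ; ∈-++⁺ʳ; ∈-map⁺)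
open import Data.List.Properties using (map-∘; length-map; length-++-sucʳ)
open import Data.List.Relation.Binary.Subset.Propositional using (_⊆_)
import Data.List.Relation.Unary.All as All
open import Data.List.Relation.Unary.AllPairs using (_∷_)
open import Data.List.Relation.Unary.Any using (here; there; satisfied)
open import Data.List.Relation.Unary.Any.Properties using (any⁻; any⁺)
open import Data.List.Relation.Unary.Unique.Propositional using (Unique)
open import Data.List.Relation.Unary.Unique.Propositional.Properties using (filter⁺; allFin⁺)
open import Data.Maybe using (Maybe; just; nothing; is-just)
open import Data.Maybe.Properties using (just-injective)
open import Data.Nat using (ℕ; zero; suc; _*_; _^_; _<ᵇ_; z≤n; s≤s)
import Data.Nat as ℕ
open import Data.Nat.Properties using (<ᵇ⇒<)
import Data.Nat.Properties as ℕ
import Data.Nat.Tactic.RingSolver as ℕ-Solver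
open import Data.Product using (∃-syntax; _×_; _,_; proj₁; proj₂)
open import Data.Sum using (_⊎_; inj₁; inj₂)
open import Function using (_∘_; flip; Equivalence)
open import Relation.Binary.PropositionalEquality hiding (J)
open import Relation.Nullary using (¬_; contradiction; yes; no)
open import Relation.Nullary.Decidable
  using (T?; ¬?; fromWitness; fromWitnessFalse; toWitness; toWitnessFalse; decidable-stable)

open import Defs

private
  variable
    A B : Set

𝟙 : Bool → ℤ
𝟙 true  = + 1
𝟙 false = + 0

𝟙-split : ∀ p q → 𝟙 p ≡ 𝟙 (p ∧ q) + 𝟙 (p ∧ not q)
𝟙-split false q     = refl
𝟙-split true  true  = refl
𝟙-split true  false = refl

𝟙-disjoint : ∀ {p q r : Bool} → (T p → T r) → (T q → T r) → (T p → T q → ⊥) → 𝟙 p + 𝟙 q ≤ 𝟙 r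
𝟙-disjoint {false} {false} {false} _   _   _ = ℤ.≤-refl
𝟙-disjoint {false} {false} {true}  _   _   _ = +≤+ z≤n
𝟙-disjoint {true}  {q}     {false} p⇒r _   _ = ⊥-elim (p⇒r _)
𝟙-disjoint {false} {true}  {false} _   q⇒r _ = ⊥-elim (q⇒r _)
𝟙-disjoint {false} {true}  {true}  _   _   _ = ℤ.≤-refl
𝟙-disjoint {true}  {false} {true}  _   _   _ = ℤ.≤-refl
𝟙-disjoint {true}  {true}  {true}  _   _   ¬pq = ⊥-elim (¬pq _ _)

¬T⇒T-not : ∀ {b} → ¬ T b → T (not b)
¬T⇒T-not {false} _  = _
¬T⇒T-not {true}  ¬t = ¬t _

∑ : List A → (A → ℤ) → ℤ
∑ xs f = sumℤ (map f xs)

∑-cong : ∀ (xs : List A) {f g : A → ℤ} → (∀ a → f a ≡ g a) → ∑ xs f ≡ ∑ xs g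
∑-cong []       f≗g = refl
∑-cong (x ∷ xs) f≗g = cong₂ _+_ (f≗g x) (∑-cong xs f≗g)

∑-mono : ∀ (xs : List A) {f g : A → ℤ} → (∀ a → f a ≤ g a) → ∑ xs f ≤ ∑ xs g
∑-mono []       f≤g = ℤ.≤-refl
∑-mono (x ∷ xs) f≤g = ℤ.+-mono-≤ (f≤g x) (∑-mono xs f≤g)

∑-zero : ∀ (xs : List A) → ∑ xs (λ _ → + 0) ≡ + 0
∑-zero []       = refl
∑-zero (x ∷ xs) = trans (ℤ.+-identityˡ _) (∑-zero xs)

∑-+ : ∀ (xs : List A) (f g : A → ℤ) → ∑ xs (λ a → f a + g a) ≡ ∑ xs f + ∑ xs g
∑-+ []       f g = refl
∑-+ (x ∷ xs) f g = begin
  f x + g x + ∑ xs (λ a → f a + g a) ≡⟨ cong (_+_ (f x + g x)) (∑-+ xs f g) ⟩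
  f x + g x + (∑ xs f + ∑ xs g)      ≡⟨ shuffle (f x) (g x) (∑ xs f) (∑ xs g) ⟩
  f x + ∑ xs f + (g x + ∑ xs g)      ∎
  where
  open ≡-Reasoning
  shuffle : ∀ a b c d → a + b + (c + d) ≡ a + c + (b + d)
  shuffle = solve-∀

∑-- : ∀ (xs : List A) (f g : A → ℤ) → ∑ xs (λ a → f a - g a) ≡ ∑ xs f - ∑ xs g
∑-- []       f g = refl
∑-- (x ∷ xs) f g = trans (cong (_+_ (f x - g x)) (∑-- xs f g)) (shuffle (f x) (g x) (∑ xs f) (∑ xs g))
  where
  shuffle : ∀ a b c d → a - b + (c - d) ≡ a + c - (b + d)
  shuffle = solve-∀

∑-*ˡ : ∀ (xs : List A) (c : ℤ) (f : A → ℤ) → ∑ xs (λ a → c *ℤ f a) ≡ c *ℤ ∑ xs f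
∑-*ˡ []       c f = sym (ℤ.*-zeroʳ c)
∑-*ˡ (x ∷ xs) c f = trans (cong (_+_ (c *ℤ f x)) (∑-*ˡ xs c f)) (sym (ℤ.*-distribˡ-+ c (f x) (∑ xs f)))

∑-++ : ∀ (xs ys : List A) (f : A → ℤ) → ∑ (xs ++ ys) f ≡ ∑ xs f + ∑ ys f
∑-++ []       ys f = sym (ℤ.+-identityˡ (∑ ys f))
∑-++ (x ∷ xs) ys f = trans (cong (_+_ (f x)) (∑-++ xs ys f)) (sym (ℤ.+-assoc (f x) (∑ xs f) (∑ ys f)))

∑-map : ∀ (g : A → B) (xs : List A) (f : B → ℤ) → ∑ (map g xs) f ≡ ∑ xs (f ∘ g)
∑-map g xs f = cong sumℤ (sym (map-∘ xs))

∑-concatMap : ∀ (g : A → List B) (xs : List A) (f : B → ℤ) →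
              ∑ (concatMap g xs) f ≡ ∑ xs (λ a → ∑ (g a) f)
∑-concatMap g []       f = refl
∑-concatMap g (x ∷ xs) f =
  trans (∑-++ (g x) (concatMap g xs) f) (cong (_+_ (∑ (g x) f)) (∑-concatMap g xs f))

∑-swap : ∀ (xs : List A) (ys : List B) (f : A → B → ℤ) →
         ∑ xs (λ a → ∑ ys (f a)) ≡ ∑ ys (λ b → ∑ xs (λ a → f a b))
∑-swap []       ys f = sym (∑-zero ys)
∑-swap (x ∷ xs) ys f = trans (cong (_+_ (∑ ys (f x))) (∑-swap xs ys f))
                             (sym (∑-+ ys (f x) (λ b → ∑ xs (λ a → f a b))))

length-filterᵇ≡∑𝟙 : ∀ (p : A → Bool) (xs : List A) → + length (filterᵇ p xs) ≡ ∑ xs (𝟙 ∘ p)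
length-filterᵇ≡∑𝟙 p []       = refl
length-filterᵇ≡∑𝟙 p (x ∷ xs) with p x
... | true  = trans (ℤ.pos-+ 1 _) (cong (_+_ (+ 1)) (length-filterᵇ≡∑𝟙 p xs))
... | false = trans (length-filterᵇ≡∑𝟙 p xs) (sym (ℤ.+-identityˡ _))

pick-∈ : ∀ c (xs : List A) {y : A} → pick c xs ≡ just y → y ∈ xs
pick-∈ c (x ∷ xs) refl = ∈-lookup (c (length xs))

is-just-pick : ∀ c {xs : List A} {y : A} → y ∈ xs → T (is-just (pick c xs))
is-just-pick c {x ∷ xs} _ = _

∈-filterᵇ⁺ : ∀ (p : A → Bool) {xs : List A} {x : A} → x ∈ xs → T (p x) → x ∈ filterᵇ p xs
∈-filterᵇ⁺ p = ∈-filter⁺ (T? ∘ p)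

∈-filterᵇ⁻ : ∀ (p : A → Bool) (xs : List A) {x : A} → x ∈ filterᵇ p xs → T (p x)
∈-filterᵇ⁻ p xs = proj₂ ∘ ∈-filter⁻ (T? ∘ p) {xs = xs}

findᵇ-just : ∀ (p : A → Bool) (xs : List A) {a : A} → findᵇ p xs ≡ just a → T (p a)
findᵇ-just p (x ∷ xs) found with p x in px
... | true  = subst (T ∘ p) (just-injective found) (Equivalence.from T-≡ px)
... | false = findᵇ-just p xs found

findᵇ-nothing : ∀ (p : A → Bool) {xs : List A} {a : A} → findᵇ p xs ≡ nothing → a ∈ xs → ¬ T (p a)
findᵇ-nothing p {x ∷ xs} notFound a∈ with p x in px
findᵇ-nothing p {x ∷ xs} notFound (here refl) | false = λ pa → subst T px pa
findᵇ-nothing p {x ∷ xs} notFound (there a∈) | false = findᵇ-nothing p notFound a∈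

unique-⊆⇒length≤ : ∀ {xs ys : List A} → Unique xs → xs ⊆ ys → length xs ℕ.≤ length ys
unique-⊆⇒length≤ {xs = []}     _              _     = z≤n
unique-⊆⇒length≤ {xs = x ∷ xs} (x∉xs ∷ uniq) xs⊆ys with ∈-∃++ (xs⊆ys (here refl))
... | ys₁ , ys₂ , refl = subst (suc (length xs) ℕ.≤_) (sym (length-++-sucʳ ys₁ x ys₂))
                           (s≤s (unique-⊆⇒length≤ uniq xs⊆ys₁++ys₂))
  where
  xs⊆ys₁++ys₂ : xs ⊆ ys₁ ++ ys₂
  xs⊆ys₁++ys₂ y∈xs with ∈-++⁻ ys₁ (xs⊆ys (there y∈xs))
  ... | inj₁ y∈ys₁         = ∈-++⁺ˡ y∈ys₁
  ... | inj₂ (here y≡x)    = contradiction (sym y≡x) (All.lookup x∉xs y∈xs)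
  ... | inj₂ (there y∈ys₂) = ∈-++⁺ʳ ys₁ y∈ys₂

count-≤-cover : ∀ {n} (p q : Fin n → Bool) (r : Fin n → Fin n) →
                (∀ x → T (p x) → ∃[ y ] T (q y) × r y ≡ x) → count p ℕ.≤ count q
count-≤-cover {n} p q r covers = begin
  count p                                ≤⟨ unique-⊆⇒length≤ (filter⁺ (T? ∘ p) (allFin⁺ n)) p⊆r[q] ⟩
  length (map r (filterᵇ q (allFin n)))  ≡⟨ length-map r (filterᵇ q (allFin n)) ⟩
  count q                                ∎
  where
  open ℕ.≤-Reasoning
  p⊆r[q] : filterᵇ p (allFin n) ⊆ map r (filterᵇ q (allFin n))
  p⊆r[q] x∈ with covers _ (∈-filterᵇ⁻ p (allFin n) x∈)
  ... | y , qy , refl = ∈-map⁺ r (∈-filterᵇ⁺ q (∈-allFin y) qy)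

least : ∀ {n} (P : Fin n → Bool) {z : Fin n} → T (P z) →
        ∃[ m ] T (P m) × (∀ y → toℕ y ℕ.< toℕ m → ¬ T (P y))
least {n} P {z} Pz with ¬∀⟶∃¬-smallest n (¬_ ∘ T ∘ P) (λ i → ¬? (T? (P i))) (λ ¬P → ¬P z Pz)
... | m , ¬¬Pm , below = m , decidable-stable (T? (P m)) ¬¬Pm , below′
  where
  below′ : ∀ y → toℕ y ℕ.< toℕ m → ¬ T (P y)
  below′ y y<m = subst (¬_ ∘ T ∘ P) (toℕ-injective (trans (toℕ-inject j) (toℕ-fromℕ< y<m))) (below j)
    where j = fromℕ< y<m

-- Summands read b only through b zero and b ∘ suc, so that the two extensions of b built by
-- allBits reduce away.
∑-allBits-suc : ∀ m (G : Bool → Bits m → ℤ) →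
                ∑ (allBits (suc m)) (λ b → G (b zero) (b ∘ suc)) ≡ ∑ (allBits m) (λ b → G false b + G true b)
∑-allBits-suc m G = trans (∑-concatMap _ (allBits m) _)
                          (∑-cong (allBits m) (λ b → cong (_+_ (G false b)) (ℤ.+-identityʳ (G true b))))

2^suc-* : ∀ m (x : ℤ) → + 2 *ℤ (+ (2 ^ m) *ℤ x) ≡ + (2 ^ suc m) *ℤ x
2^suc-* m x = trans (sym (ℤ.*-assoc (+ 2) (+ (2 ^ m)) x)) (cong (_*ℤ x) (sym (ℤ.pos-* 2 (2 ^ m))))

∑-allBits-tail : ∀ m (F : Bits m → ℤ) → ∑ (allBits (suc m)) (λ b → F (b ∘ suc)) ≡ + 2 *ℤ ∑ (allBits m) F
∑-allBits-tail m F = begin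
  ∑ (allBits (suc m)) (λ b → F (b ∘ suc)) ≡⟨ ∑-allBits-suc m (λ _ → F) ⟩
  ∑ (allBits m) (λ b → F b + F b)         ≡⟨ ∑-+ (allBits m) F F ⟩
  ∑ (allBits m) F + ∑ (allBits m) F       ≡⟨ double (∑ (allBits m) F) ⟩
  + 2 *ℤ ∑ (allBits m) F                  ∎
  where
  open ≡-Reasoning
  double : ∀ x → x + x ≡ + 2 *ℤ x
  double = solve-∀

∑-allBits-const : ∀ m (c : ℤ) → ∑ (allBits m) (λ _ → c) ≡ + (2 ^ m) *ℤ c
∑-allBits-const zero    c = trans (ℤ.+-identityʳ c) (sym (ℤ.*-identityˡ c))
∑-allBits-const (suc m) c = begin
  ∑ (allBits (suc m)) (λ _ → c)  ≡⟨ ∑-allBits-tail m (λ _ → c) ⟩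
  + 2 *ℤ ∑ (allBits m) (λ _ → c) ≡⟨ cong (+ 2 *ℤ_) (∑-allBits-const m c) ⟩
  + 2 *ℤ (+ (2 ^ m) *ℤ c)        ≡⟨ 2^suc-* m c ⟩
  + (2 ^ suc m) *ℤ c             ∎
  where open ≡-Reasoning

∑-allBits-bit : ∀ m (j : Fin m) (g : Bool → ℤ) →
                + 2 *ℤ ∑ (allBits m) (λ b → g (b j)) ≡ + (2 ^ m) *ℤ (g false + g true)
∑-allBits-bit (suc m) zero g = begin
  + 2 *ℤ ∑ (allBits (suc m)) (λ b → g (b zero))  ≡⟨ cong (+ 2 *ℤ_) (∑-allBits-suc m (λ x _ → g x)) ⟩
  + 2 *ℤ ∑ (allBits m) (λ _ → g false + g true)  ≡⟨ cong (+ 2 *ℤ_) (∑-allBits-const m (g false + g true)) ⟩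
  + 2 *ℤ (+ (2 ^ m) *ℤ (g false + g true))       ≡⟨ 2^suc-* m (g false + g true) ⟩
  + (2 ^ suc m) *ℤ (g false + g true)            ∎
  where open ≡-Reasoning
∑-allBits-bit (suc m) (suc j) g = begin
  + 2 *ℤ ∑ (allBits (suc m)) (λ b → g (b (suc j)))  ≡⟨ cong (+ 2 *ℤ_) (∑-allBits-tail m (λ b → g (b j))) ⟩
  + 2 *ℤ (+ 2 *ℤ ∑ (allBits m) (λ b → g (b j)))     ≡⟨ cong (+ 2 *ℤ_) (∑-allBits-bit m j g) ⟩
  + 2 *ℤ (+ (2 ^ m) *ℤ (g false + g true))          ≡⟨ 2^suc-* m (g false + g true) ⟩
  + (2 ^ suc m) *ℤ (g false + g true)               ∎
  where open ≡-Reasoning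

∑-allBits-pair : ∀ m {i j : Fin m} → i ≢ j → (g : Bool → Bool → ℤ) →
                 + 4 *ℤ ∑ (allBits m) (λ b → g (b i) (b j))
                   ≡ + (2 ^ m) *ℤ (g false false + g false true + g true false + g true true)
∑-allBits-pair (suc m) {zero}  {zero}  i≢j g = contradiction refl i≢j
∑-allBits-pair (suc m) {zero}  {suc j} i≢j g = begin
  + 4 *ℤ ∑ (allBits (suc m)) (λ b → g (b zero) (b (suc j)))
    ≡⟨ cong (+ 4 *ℤ_) (∑-allBits-suc m (λ x b → g x (b j))) ⟩
  + 4 *ℤ ∑ (allBits m) (λ b → g false (b j) + g true (b j))
    ≡⟨ ℤ.*-assoc (+ 2) (+ 2) _ ⟩
  + 2 *ℤ (+ 2 *ℤ ∑ (allBits m) (λ b → g false (b j) + g true (b j)))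
    ≡⟨ cong (+ 2 *ℤ_) (∑-allBits-bit m j (λ y → g false y + g true y)) ⟩
  + 2 *ℤ (+ (2 ^ m) *ℤ (g false false + g true false + (g false true + g true true)))
    ≡⟨ 2^suc-* m _ ⟩
  + (2 ^ suc m) *ℤ (g false false + g true false + (g false true + g true true))
    ≡⟨ cong (+ (2 ^ suc m) *ℤ_) (middle-swap (g false false) (g true false) (g false true) (g true true)) ⟩
  + (2 ^ suc m) *ℤ (g false false + g false true + g true false + g true true) ∎
  where
  open ≡-Reasoning
  middle-swap : ∀ a b c d → a + b + (c + d) ≡ a + c + b + d
  middle-swap = solve-∀
∑-allBits-pair (suc m) {suc i} {zero}  i≢j g =
  trans (∑-allBits-pair (suc m) (i≢j ∘ sym) (flip g))
        (cong (+ (2 ^ suc m) *ℤ_) (middle-swap (g false false) (g true false) (g false true) (g true true)))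
  where
  middle-swap : ∀ a b c d → a + b + c + d ≡ a + c + b + d
  middle-swap = solve-∀
∑-allBits-pair (suc m) {suc i} {suc j} i≢j g = begin
  + 4 *ℤ ∑ (allBits (suc m)) (λ b → g (b (suc i)) (b (suc j)))
    ≡⟨ cong (+ 4 *ℤ_) (∑-allBits-tail m (λ b → g (b i) (b j))) ⟩
  + 4 *ℤ (+ 2 *ℤ ∑ (allBits m) (λ b → g (b i) (b j)))
    ≡⟨ *-comm-middle (+ 4) (+ 2) _ ⟩
  + 2 *ℤ (+ 4 *ℤ ∑ (allBits m) (λ b → g (b i) (b j)))
    ≡⟨ cong (+ 2 *ℤ_) (∑-allBits-pair m (i≢j ∘ cong suc) g) ⟩
  + 2 *ℤ (+ (2 ^ m) *ℤ (g false false + g false true + g true false + g true true))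
    ≡⟨ 2^suc-* m _ ⟩
  + (2 ^ suc m) *ℤ (g false false + g false true + g true false + g true true) ∎
  where
  open ≡-Reasoning
  *-comm-middle : ∀ a b c → a *ℤ (b *ℤ c) ≡ b *ℤ (a *ℤ c)
  *-comm-middle = solve-∀

module RoundProperties {n} (H : Graph n) (cY cZ : Fin n → (k : ℕ) → Fin (suc k))
                       (ℓ : LeaderMap n) (b : Bits n) where

  R : LeaderMap n
  R = round H cY cZ ℓ b

  -- Unfolds to the message that y selects inside round.
  selection : Fin n → Maybe (Fin n)
  selection y = if b (ℓ y) then nothing else pick (cY y) (filterᵇ (λ x → H x y ∧ b (ℓ x)) (allFin n))

  forwardsTo : Fin n → Fin n → Bool
  forwardsTo z y = (ℓ y == z) ∧ is-just (selection y)

  selection-bit : ∀ y {x} → selection y ≡ just x → T (b (ℓ x))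
  selection-bit y sel≡x with b (ℓ y)
  ... | false = proj₂ (Equivalence.to T-∧ (∈-filterᵇ⁻ _ (allFin n) (pick-∈ (cY y) _ sel≡x)))

  round-cases : ∀ v → R v ≡ ℓ v ⊎ ∃[ x ] R v ≡ ℓ x × T (b (ℓ x))
  round-cases v with b (ℓ (ℓ v))
  ... | true  = inj₁ refl
  ... | false with pick (cZ (ℓ v)) (filterᵇ (forwardsTo (ℓ v)) (allFin n))
  ...   | nothing = inj₁ refl
  ...   | just y with selection y in sel≡
  ...     | nothing = inj₁ refl
  ...     | just x  = inj₂ (x , refl , selection-bit y sel≡)

  round-respects : ∀ {u v} → ℓ u ≡ ℓ v → R u ≡ R v
  round-respects ℓu≡ℓv rewrite ℓu≡ℓv = refl

  selection-isJust : ∀ {a c} → b (ℓ c) ≡ false → T (H a c) → T (b (ℓ a)) → T (is-just (selection c))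
  selection-isJust {a} {c} bc≡0 Hac ba rewrite bc≡0 =
    is-just-pick (cY c) (∈-filterᵇ⁺ _ (∈-allFin a) (Equivalence.from T-∧ (Hac , ba)))

  round-bit1-unchanged : ∀ v → T (b (ℓ (ℓ v))) → R v ≡ ℓ v
  round-bit1-unchanged v bit with b (ℓ (ℓ v))
  ... | true = refl

  module _ (isL : IsLeaderMap ℓ) where

    ℓ∘round≡round : ∀ v → ℓ (R v) ≡ R v
    ℓ∘round≡round v with round-cases v
    ... | inj₁ Rv≡ℓv           = trans (cong ℓ Rv≡ℓv) (trans (isL v) (sym Rv≡ℓv))
    ... | inj₂ (x , Rv≡ℓx , _) = trans (cong ℓ Rv≡ℓx) (trans (isL x) (sym Rv≡ℓx))

    round-isLeaderMap : IsLeaderMap R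
    round-isLeaderMap v with round-cases v
    ... | inj₁ Rv≡ℓv = trans (cong R Rv≡ℓv) (round-respects (isL v))
    ... | inj₂ (x , Rv≡ℓx , bit) = begin
      R (R v)      ≡⟨ cong R Rv≡ℓx ⟩
      R (ℓ x)      ≡⟨ round-bit1-unchanged (ℓ x) (subst (T ∘ b) (sym (trans (isL (ℓ x)) (isL x))) bit) ⟩
      ℓ (ℓ x)      ≡⟨ isL x ⟩
      ℓ x          ≡⟨ Rv≡ℓx ⟨
      R v          ∎
      where open ≡-Reasoning

    round-absorbs : ∀ v {a c} → b (ℓ v) ≡ false → T (H a c) → ℓ c ≡ ℓ v → T (b (ℓ a)) → T (b (R v))
    round-absorbs v {a} {c} bv≡0 Hac ℓc≡ℓv ba with b (ℓ (ℓ v)) in bℓℓv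
    ... | true  = contradiction (trans (sym bℓℓv) (trans (cong b (isL v)) bv≡0)) λ ()
    ... | false with pick (cZ (ℓ v)) (filterᵇ (forwardsTo (ℓ v)) (allFin n)) in picked
    ...   | nothing = ⊥-elim (subst (T ∘ is-just) picked (is-just-pick (cZ (ℓ v)) c-forwards))
      where
      c-forwards : c ∈ filterᵇ (forwardsTo (ℓ v)) (allFin n)
      c-forwards = ∈-filterᵇ⁺ (forwardsTo (ℓ v)) (∈-allFin c)
        (Equivalence.from T-∧ (fromWitness ℓc≡ℓv , selection-isJust (trans (cong b ℓc≡ℓv) bv≡0) Hac ba))
    ...   | just y with selection y in sel≡
    ...     | just x  = selection-bit y sel≡
    ...     | nothing = ⊥-elim (subst (T ∘ is-just) sel≡
                          (proj₂ (Equivalence.to T-∧ (∈-filterᵇ⁻ _ (allFin n) (pick-∈ (cZ (ℓ v)) _ picked)))))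

module Borders {n} (H : Graph n) (ℓ : LeaderMap n) where

  isLeader : Fin n → Bool
  isLeader x = ℓ x == x

  bordering : Fin n → Fin n → Bool
  bordering z a = not (ℓ a == z) ∧ any (λ c → H a c ∧ (ℓ c == z)) (allFin n)

  borderVertex : Fin n → Maybe (Fin n)
  borderVertex z = findᵇ (bordering z) (allFin n)

  nonIsolatedLeader isolatedLeader : Fin n → Bool
  nonIsolatedLeader x = isLeader x ∧ is-just (borderVertex x)
  isolatedLeader    x = isLeader x ∧ not (is-just (borderVertex x))

  absorbedVia : Fin n → Bits n → Maybe (Fin n) → Bool
  absorbedVia z b nothing  = false
  absorbedVia z b (just a) = not (b z) ∧ b (ℓ a)

  -- Fixing the witness borderVertex z makes the probability exactly 1/4.
  absorbed : Fin n → Bits n → Bool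
  absorbed z b = isLeader z ∧ absorbedVia z b (borderVertex z)

  bordering⁺ : ∀ {z a c} → ℓ a ≢ z → T (H a c) → ℓ c ≡ z → T (bordering z a)
  bordering⁺ {c = c} ℓa≢z Hac ℓc≡z = Equivalence.from T-∧
    (fromWitnessFalse ℓa≢z , any⁺ _ (lose (∈-allFin c) (Equivalence.from T-∧ (Hac , fromWitness ℓc≡z))))

  bordering⁻ : ∀ {z a} → T (bordering z a) → ℓ a ≢ z × ∃[ c ] T (H a c) × ℓ c ≡ z
  bordering⁻ {z} {a} borders with Equivalence.to (T-∧ {not (ℓ a == z)}) borders
  ... | ℓa≢z , edge-into-z with satisfied (any⁻ _ (allFin n) edge-into-z)
  ...   | c , edge with Equivalence.to (T-∧ {H a c}) edge
  ...     | Hac , ℓc≡z = toWitnessFalse ℓa≢z , c , Hac , toWitness ℓc≡z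

  absorbed-inv : ∀ {z b} → T (absorbed z b) →
                 T (isLeader z) × b z ≡ false × ∃[ a ] T (bordering z a) × T (b (ℓ a))
  absorbed-inv {z} {b} abs with borderVertex z in found | Equivalence.to (T-∧ {isLeader z}) abs
  ... | nothing | _ , ()
  ... | just a  | leader , bits =
    let bz≡0 , ba = Equivalence.to T-∧ bits in leader , Equivalence.to T-not-≡ bz≡0 , a , findᵇ-just _ (allFin n) found , ba

  leader-or-absorbed : IsLeaderMap ℓ → ∀ cY cZ b x →
                       𝟙 (round H cY cZ ℓ b x == x) + 𝟙 (absorbed x b) ≤ 𝟙 (isLeader x)
  leader-or-absorbed isL cY cZ b x = 𝟙-disjoint stays (proj₁ ∘ Equivalence.to T-∧) moves
    where
    open RoundProperties H cY cZ ℓ b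
    stays : T (R x == x) → T (isLeader x)
    stays Rx≡x = fromWitness (begin
      ℓ x     ≡⟨ cong ℓ (toWitness Rx≡x) ⟨
      ℓ (R x) ≡⟨ ℓ∘round≡round isL x ⟩
      R x     ≡⟨ toWitness Rx≡x ⟩
      x       ∎)
      where open ≡-Reasoning
    moves : T (R x == x) → T (absorbed x b) → ⊥
    moves Rx≡x abs with absorbed-inv abs
    ... | leader , bx≡0 , a , borders , ba with bordering⁻ borders
    ...   | _ , c , Hac , ℓc≡x = subst T bx≡0 (subst (T ∘ b) (toWitness Rx≡x) bRx)
      where
      ℓx≡x : ℓ x ≡ x
      ℓx≡x = toWitness leader
      bRx : T (b (R x))
      bRx = round-absorbs isL x (trans (cong b ℓx≡x) bx≡0) Hac (trans ℓc≡x (sym ℓx≡x)) ba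

  absorbed-probability : ∀ x → + 4 *ℤ ∑ (allBits n) (𝟙 ∘ absorbed x) ≡ + (2 ^ n) *ℤ 𝟙 (nonIsolatedLeader x)
  absorbed-probability x with isLeader x
  ... | false = trans (cong (+ 4 *ℤ_) (∑-zero (allBits n))) (sym (ℤ.*-zeroʳ (+ (2 ^ n))))
  ... | true with borderVertex x in found
  ...   | nothing = trans (cong (+ 4 *ℤ_) (∑-zero (allBits n))) (sym (ℤ.*-zeroʳ (+ (2 ^ n))))
  ...   | just a  = ∑-allBits-pair n (ℓa≢x ∘ sym) (λ c d → 𝟙 (not c ∧ d))
    where
    ℓa≢x : ℓ a ≢ x
    ℓa≢x = proj₁ (bordering⁻ (findᵇ-just _ (allFin n) found))

Refines : ∀ {n} → LeaderMap n → LeaderMap n → Set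
Refines {n} ℓ₀ ℓ = (a c : Fin n) → ℓ₀ a ≡ ℓ₀ c → ℓ a ≡ ℓ c

module IsolatedParts {n} (H : Graph n) (ℓ₀ ℓ : LeaderMap n) (coarser : Refines ℓ₀ ℓ) where

  open Borders H ℓ

  G : Graph n
  G = joinAdj ℓ₀ H

  componentMinimum : Fin n → Bool
  componentMinimum m = not (any (λ y → (toℕ y <ᵇ toℕ m) ∧ connected G y m) (allFin n))

  module _ {x : Fin n} (isolated : borderVertex x ≡ nothing) where

    edge-closed : ∀ {a c} → T (H a c) → ℓ c ≡ x → ℓ a ≡ x
    edge-closed {a} {c} Hac ℓc≡x with ℓ a ≟ x
    ... | yes ℓa≡x = ℓa≡x
    ... | no  ℓa≢x =
      contradiction (bordering⁺ ℓa≢x Hac ℓc≡x) (findᵇ-nothing (bordering x) isolated (∈-allFin a))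

    join-closed : ∀ {a c} → T (G a c) → ℓ c ≡ x → ℓ a ≡ x
    join-closed {a} {c} Gac ℓc≡x with Equivalence.to (T-∨ {H a c}) Gac
    ... | inj₁ Hac  = edge-closed Hac ℓc≡x
    ... | inj₂ same = trans (coarser a c (toWitness same)) ℓc≡x

    reach-closed : ∀ k {y w} → T (reach G k y w) → ℓ w ≡ x → ℓ y ≡ x
    reach-closed zero    y≡w ℓw≡x = trans (cong ℓ (toWitness y≡w)) ℓw≡x
    reach-closed (suc k) {y} {w} y↝w ℓw≡x with Equivalence.to (T-∨ {reach G k y w}) y↝w
    ... | inj₁ y↝w′ = reach-closed k y↝w′ ℓw≡x
    ... | inj₂ via with satisfied (any⁻ _ (allFin n) via)
    ...   | u , y↝u→w = reach-closed k (proj₁ steps) (join-closed (proj₂ steps) ℓw≡x)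
      where
      steps : T (reach G k y u) × T (G u w)
      steps = Equivalence.to T-∧ y↝u→w

  isolated≤components : count isolatedLeader ℕ.≤ numJoin ℓ₀ H
  isolated≤components = count-≤-cover isolatedLeader componentMinimum ℓ leastOfPart
    where
    leastOfPart : ∀ x → T (isolatedLeader x) → ∃[ m ] T (componentMinimum m) × ℓ m ≡ x
    leastOfPart x iso with least (λ y → ℓ y == x) (proj₁ (Equivalence.to T-∧ iso))
    ... | m , ℓm≡x , minimal = m , ¬T⇒T-not nothing-below , toWitness ℓm≡x
      where
      isolated : borderVertex x ≡ nothing
      isolated with borderVertex x | proj₂ (Equivalence.to (T-∧ {isLeader x}) iso)
      ... | nothing | _ = refl
      nothing-below : ¬ T (any (λ y → (toℕ y <ᵇ toℕ m) ∧ connected G y m) (allFin n))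
      nothing-below below with satisfied (any⁻ _ (allFin n) below)
      ... | y , y<m∧y↝m with Equivalence.to (T-∧ {toℕ y <ᵇ toℕ m}) y<m∧y↝m
      ...   | y<m , y↝m = minimal y (<ᵇ⇒< (toℕ y) (toℕ m) y<m)
                            (fromWitness (reach-closed isolated n y↝m (toWitness ℓm≡x)))

module OneRound {n} (H : Graph n) (ℓ₀ ℓ : LeaderMap n) (isL : IsLeaderMap ℓ) (coarser : Refines ℓ₀ ℓ) where

  open Borders H ℓ
  open IsolatedParts H ℓ₀ ℓ coarser using (isolated≤components)

  K P N I J : ℤ
  K = + (2 ^ n)
  P = + numParts ℓ
  N = ∑ (allFin n) (𝟙 ∘ nonIsolatedLeader)
  I = ∑ (allFin n) (𝟙 ∘ isolatedLeader)
  J = + numJoin ℓ₀ H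

  parts-split : P ≡ N + I
  parts-split = begin
    P                                                   ≡⟨ length-filterᵇ≡∑𝟙 isLeader (allFin n) ⟩
    ∑ (allFin n) (𝟙 ∘ isLeader)                         ≡⟨ ∑-cong (allFin n) (λ x → 𝟙-split (isLeader x) _) ⟩
    ∑ (allFin n) (λ x → 𝟙 (nonIsolatedLeader x) + 𝟙 (isolatedLeader x)) ≡⟨ ∑-+ (allFin n) _ _ ⟩
    N + I                                               ∎
    where open ≡-Reasoning

  isolated≤join : I ≤ J
  isolated≤join = subst (_≤ J) (length-filterᵇ≡∑𝟙 isolatedLeader (allFin n)) (+≤+ isolated≤components)

  isolated-excess : K *ℤ (P - N - J) ≤ + 0
  isolated-excess = begin
    K *ℤ (P - N - J)   ≡⟨ cong (λ p → K *ℤ (p - N - J)) parts-split ⟩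
    K *ℤ (N + I - N - J) ≡⟨ cong (λ i → K *ℤ (i - J)) (cancel N I) ⟩
    K *ℤ (I - J)       ≤⟨ ℤ.*-monoˡ-≤-nonNeg K (ℤ.i≤j⇒i-j≤0 isolated≤join) ⟩
    K *ℤ + 0           ≡⟨ ℤ.*-zeroʳ K ⟩
    + 0                ∎
    where
    open ℤ.≤-Reasoning
    cancel : ∀ a i → a + i - a ≡ i
    cancel = solve-∀

  expected-absorptions : K *ℤ N ≡ + 4 *ℤ ∑ (allBits n) (λ b → ∑ (allFin n) (λ x → 𝟙 (absorbed x b)))
  expected-absorptions = begin
    K *ℤ N                                                        ≡⟨ ∑-*ˡ (allFin n) K _ ⟨
    ∑ (allFin n) (λ x → K *ℤ 𝟙 (nonIsolatedLeader x))             ≡⟨ ∑-cong (allFin n) absorbed-probability ⟨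
    ∑ (allFin n) (λ x → + 4 *ℤ ∑ (allBits n) (𝟙 ∘ absorbed x))    ≡⟨ ∑-*ˡ (allFin n) (+ 4) _ ⟩
    + 4 *ℤ ∑ (allFin n) (λ x → ∑ (allBits n) (𝟙 ∘ absorbed x))
      ≡⟨ cong (+ 4 *ℤ_) (∑-swap (allFin n) (allBits n) _) ⟩
    + 4 *ℤ ∑ (allBits n) (λ b → ∑ (allFin n) (λ x → 𝟙 (absorbed x b))) ∎
    where open ≡-Reasoning

  module _ (cY cZ : Bits n → Fin n → (k : ℕ) → Fin (suc k)) where

    next : Bits n → LeaderMap n
    next b = round H (cY b) (cZ b) ℓ b

    #leaders #absorbed : Bits n → ℤ
    #leaders  b = ∑ (allFin n) (λ x → 𝟙 (next b x == x))
    #absorbed b = ∑ (allFin n) (λ x → 𝟙 (absorbed x b))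

    ∑-leaders-or-absorbed : ∑ (allBits n) (λ b → #leaders b + #absorbed b) ≤ K *ℤ P
    ∑-leaders-or-absorbed = begin
      ∑ (allBits n) (λ b → #leaders b + #absorbed b)
        ≡⟨ ∑-cong (allBits n) (λ b → ∑-+ (allFin n) _ _) ⟨
      ∑ (allBits n) (λ b → ∑ (allFin n) (λ x → 𝟙 (next b x == x) + 𝟙 (absorbed x b)))
        ≤⟨ ∑-mono (allBits n) (λ b → ∑-mono (allFin n) (leader-or-absorbed isL (cY b) (cZ b) b)) ⟩
      ∑ (allBits n) (λ _ → ∑ (allFin n) (𝟙 ∘ isLeader))
        ≡⟨ ∑-allBits-const n _ ⟩
      K *ℤ ∑ (allFin n) (𝟙 ∘ isLeader)
        ≡⟨ cong (K *ℤ_) (length-filterᵇ≡∑𝟙 isLeader (allFin n)) ⟨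
      K *ℤ P ∎
      where open ℤ.≤-Reasoning

    expected-leaders : + 4 *ℤ ∑ (allBits n) (λ b → + numParts (next b)) + K *ℤ N ≤ + 4 *ℤ (K *ℤ P)
    expected-leaders = begin
      + 4 *ℤ ∑ (allBits n) (λ b → + numParts (next b)) + K *ℤ N
        ≡⟨ cong₂ (λ s t → + 4 *ℤ s + t)
                 (∑-cong (allBits n) (λ b → length-filterᵇ≡∑𝟙 _ (allFin n))) expected-absorptions ⟩
      + 4 *ℤ ∑ (allBits n) #leaders + + 4 *ℤ ∑ (allBits n) #absorbed
        ≡⟨ trans (cong (+ 4 *ℤ_) (∑-+ (allBits n) #leaders #absorbed))
                 (ℤ.*-distribˡ-+ (+ 4) (∑ (allBits n) #leaders) (∑ (allBits n) #absorbed)) ⟨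
      + 4 *ℤ ∑ (allBits n) (λ b → #leaders b + #absorbed b)
        ≤⟨ ℤ.*-monoˡ-≤-nonNeg (+ 4) ∑-leaders-or-absorbed ⟩
      + 4 *ℤ (K *ℤ P) ∎
      where open ℤ.≤-Reasoning

    one-round : + 4 *ℤ ∑ (allBits n) (λ b → + numParts (next b) - J) ≤ + (3 * 2 ^ n) *ℤ (P - J)
    one-round = begin
      + 4 *ℤ ∑ (allBits n) (λ b → + numParts (next b) - J)
        ≡⟨ cong (+ 4 *ℤ_) (trans (∑-- (allBits n) _ (λ _ → J)) (cong (_-_ S) (∑-allBits-const n J))) ⟩
      + 4 *ℤ (S - K *ℤ J)
        ≡⟨ regroup S (K *ℤ N) (K *ℤ J) ⟩
      (+ 4 *ℤ S + K *ℤ N) - (K *ℤ N + + 4 *ℤ (K *ℤ J))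
        ≤⟨ ℤ.+-monoˡ-≤ (- (K *ℤ N + + 4 *ℤ (K *ℤ J))) expected-leaders ⟩
      + 4 *ℤ (K *ℤ P) - (K *ℤ N + + 4 *ℤ (K *ℤ J))
        ≡⟨ regroup′ K P N J ⟩
      + 3 *ℤ K *ℤ (P - J) + K *ℤ (P - N - J)
        ≤⟨ ℤ.+-monoʳ-≤ (+ 3 *ℤ K *ℤ (P - J)) isolated-excess ⟩
      + 3 *ℤ K *ℤ (P - J) + + 0
        ≡⟨ trans (ℤ.+-identityʳ _) (cong (_*ℤ (P - J)) (sym (ℤ.pos-* 3 (2 ^ n)))) ⟩
      + (3 * 2 ^ n) *ℤ (P - J) ∎
      where
      open ℤ.≤-Reasoning
      S = ∑ (allBits n) (λ b → + numParts (next b))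
      regroup : ∀ s a c → + 4 *ℤ (s - c) ≡ (+ 4 *ℤ s + a) - (a + + 4 *ℤ c)
      regroup = solve-∀
      regroup′ : ∀ k p a j → + 4 *ℤ (k *ℤ p) - (k *ℤ a + + 4 *ℤ (k *ℤ j))
                             ≡ + 3 *ℤ k *ℤ (p - j) + k *ℤ (p - a - j)
      regroup′ = solve-∀

rate-suc : ∀ n h (x : ℤ) →
           + (3 ^ h * 2 ^ (n * h)) *ℤ (+ (3 * 2 ^ n) *ℤ x) ≡ + (3 ^ suc h * 2 ^ (n * suc h)) *ℤ x
rate-suc n h x = begin
  + (3 ^ h * 2 ^ (n * h)) *ℤ (+ (3 * 2 ^ n) *ℤ x)   ≡⟨ ℤ.*-assoc (+ (3 ^ h * 2 ^ (n * h))) (+ (3 * 2 ^ n)) x ⟨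
  + (3 ^ h * 2 ^ (n * h)) *ℤ + (3 * 2 ^ n) *ℤ x     ≡⟨ cong (_*ℤ x) (ℤ.pos-* (3 ^ h * 2 ^ (n * h)) (3 * 2 ^ n)) ⟨
  + (3 ^ h * 2 ^ (n * h) * (3 * 2 ^ n)) *ℤ x        ≡⟨ cong (λ k → + k *ℤ x) powers ⟩
  + (3 ^ suc h * 2 ^ (n * suc h)) *ℤ x              ∎
  where
  open ≡-Reasoning
  rearrange : ∀ a b k → a * b * (3 * k) ≡ 3 * a * (k * b)
  rearrange = ℕ-Solver.solve-∀
  powers : 3 ^ h * 2 ^ (n * h) * (3 * 2 ^ n) ≡ 3 ^ suc h * 2 ^ (n * suc h)
  powers = begin
    3 ^ h * 2 ^ (n * h) * (3 * 2 ^ n)   ≡⟨ rearrange (3 ^ h) (2 ^ (n * h)) (2 ^ n) ⟩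
    3 ^ suc h * (2 ^ n * 2 ^ (n * h))   ≡⟨ cong (3 ^ suc h *_) (ℕ.^-distribˡ-+-* 2 n (n * h)) ⟨
    3 ^ suc h * 2 ^ (n ℕ.+ n * h)       ≡⟨ cong (λ e → 3 ^ suc h * 2 ^ e) (ℕ.*-suc n h) ⟨
    3 ^ suc h * 2 ^ (n * suc h)         ∎

module Rounds {n} (H : Graph n) (cY cZ : Chooser n) (ℓ₀ : LeaderMap n) where

  J : ℤ
  J = + numJoin ℓ₀ H

  excess : List (Bits n) → LeaderMap n → ℕ → ℤ
  excess hist ℓ h = ∑ (allSeqs n h) (λ s → + numParts (runFrom H cY cZ hist ℓ s) - J)

  next : List (Bits n) → LeaderMap n → Bits n → LeaderMap n
  next hist ℓ b = round H (cY (hist ∷ʳ b)) (cZ (hist ∷ʳ b)) ℓ b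

  excess-suc : ∀ hist ℓ h →
               excess hist ℓ (suc h) ≡ ∑ (allBits n) (λ b → excess (hist ∷ʳ b) (next hist ℓ b) h)
  excess-suc hist ℓ h = trans (∑-concatMap _ (allBits n) _)
                              (∑-cong (allBits n) (λ b → ∑-map (b ∷_) (allSeqs n h) _))

  excess-bound : ∀ h hist ℓ → IsLeaderMap ℓ → Refines ℓ₀ ℓ →
                 + (4 ^ h) *ℤ excess hist ℓ h ≤ + (3 ^ h * 2 ^ (n * h)) *ℤ (+ numParts ℓ - J)
  excess-bound zero hist ℓ _ _ = ℤ.≤-reflexive (begin
    + 1 *ℤ (+ numParts ℓ - J + + 0)          ≡⟨ trans (ℤ.*-identityˡ _) (ℤ.+-identityʳ _) ⟩
    + numParts ℓ - J                         ≡⟨ ℤ.*-identityˡ _ ⟨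
    + 1 *ℤ (+ numParts ℓ - J)
      ≡⟨ cong (λ m → + (1 * 2 ^ m) *ℤ (+ numParts ℓ - J)) (ℕ.*-zeroʳ n) ⟨
    + (1 * 2 ^ (n * 0)) *ℤ (+ numParts ℓ - J) ∎)
    where open ≡-Reasoning
  excess-bound (suc h) hist ℓ isL coarser = begin
    + (4 ^ suc h) *ℤ excess hist ℓ (suc h)
      ≡⟨ cong₂ _*ℤ_ (ℤ.pos-* 4 (4 ^ h)) (excess-suc hist ℓ h) ⟩
    + 4 *ℤ + (4 ^ h) *ℤ ∑ (allBits n) (λ b → excess (hist ∷ʳ b) (next hist ℓ b) h)
      ≡⟨ trans (ℤ.*-assoc (+ 4) (+ (4 ^ h)) _) (cong (+ 4 *ℤ_) (sym (∑-*ˡ (allBits n) (+ (4 ^ h)) _))) ⟩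
    + 4 *ℤ ∑ (allBits n) (λ b → + (4 ^ h) *ℤ excess (hist ∷ʳ b) (next hist ℓ b) h)
      ≤⟨ ℤ.*-monoˡ-≤-nonNeg (+ 4) (∑-mono (allBits n) induction) ⟩
    + 4 *ℤ ∑ (allBits n) (λ b → c *ℤ (+ numParts (next hist ℓ b) - J))
      ≡⟨ trans (cong (+ 4 *ℤ_) (∑-*ˡ (allBits n) c _)) (*-comm-middle (+ 4) c _) ⟩
    c *ℤ (+ 4 *ℤ ∑ (allBits n) (λ b → + numParts (next hist ℓ b) - J))
      ≤⟨ ℤ.*-monoˡ-≤-nonNeg c (one-round (λ b → cY (hist ∷ʳ b)) (λ b → cZ (hist ∷ʳ b))) ⟩
    c *ℤ (+ (3 * 2 ^ n) *ℤ (+ numParts ℓ - J))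
      ≡⟨ rate-suc n h (+ numParts ℓ - J) ⟩
    + (3 ^ suc h * 2 ^ (n * suc h)) *ℤ (+ numParts ℓ - J) ∎
    where
    open ℤ.≤-Reasoning
    open OneRound H ℓ₀ ℓ isL coarser using (one-round)
    c : ℤ
    c = + (3 ^ h * 2 ^ (n * h))
    induction : ∀ b → + (4 ^ h) *ℤ excess (hist ∷ʳ b) (next hist ℓ b) h
                      ≤ c *ℤ (+ numParts (next hist ℓ b) - J)
    induction b = excess-bound h (hist ∷ʳ b) (next hist ℓ b)
                    (RoundProperties.round-isLeaderMap H _ _ ℓ b isL)
                    (λ u v ℓ₀u≡ℓ₀v → RoundProperties.round-respects H _ _ ℓ b (coarser u v ℓ₀u≡ℓ₀v))
    *-comm-middle : ∀ a b c → a *ℤ (b *ℤ c) ≡ b *ℤ (a *ℤ c)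
    *-comm-middle = solve-∀

lemma3p10 : (n : ℕ) (H : Graph n) → Symmetric H → Irreflexive H →
            (ℓ : LeaderMap n) → IsLeaderMap ℓ →
            (cY cZ : Chooser n) (h : ℕ) →
            + (4 ^ h) *ℤ sumExcess H cY cZ ℓ h
              ≤ + (3 ^ h * 2 ^ (n * h)) *ℤ (+ numParts ℓ - + numJoin ℓ H)
lemma3p10 n H _ _ ℓ isL cY cZ h = Rounds.excess-bound H cY cZ ℓ h [] ℓ isL (λ _ _ ℓa≡ℓc → ℓa≡ℓc)
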